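{- Let $d\geq 1$, $m\geq 3$ and $s=2d+3$, and let $n$ be a positive multiple of $s$. Let $0\leq \ell<n$ and let $X=C_m\times^{\sigma_\ell} C_n$ be the direct graph bundle with base $C_m$, fibre $C_n$ and cyclic $\ell$-shift $\sigma_\ell$. Suppose that $\ell=[ks+(-1)^a 2m]\bmod n$ for some $a\in\{1,2\}$ and $k\in\mathbb{Z}$, or that $\ell=[ks-(-1)^a(d+1)m]\bmod n$ for some $a\in\{1,2\}$ and $k\in\mathbb{Z}$. Then $\lambda^d_1(X)\leq 2d+2$, and $\lambda^d_1(X)=2d+2$ if $1\leq d\leq 4$.
   Context: For $n\geq 3$, the cycle $C_n$ has vertex set $\{0,1,\dots,n-1\}$ with $i$ adjacent to $j$ iff $i\equiv j\pm 1 \pmod n$. The cyclic $\ell$-shift is the automorphism $\sigma_\ell(j)=(j+\ell)\bmod n$ of $C_n$. The direct graph bundle $C_m\times^{\sigma_\ell}C_n$ has vertex set $\{0,\dots,m-1\}\times\{0,\dots,n-1\}$; for $0\leq i\leq m-2$ and every edge $j_1j_2$ of $C_n$, the vertices $(i,j_1)$ and $(i+1,j_2)$ are adjacent; and for every edge $j_1j_2$ of $C_n$, the vertices $(m-1,j_1)$ and $(0,\sigma_\ell(j_2))$ are adjacent; there are no other edges. (For $\ell=0$ this is the direct product $C_m\times C_n$.) For an integer $d\geq 1$, an $L(d,1)$-labeling of a graph $G$ is a map $f:V(G)\to\{0,1,2,\dots\}$ such that $|f(u)-f(v)|\geq d$ whenever $u,v$ are adjacent and $|f(u)-f(v)|\geq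 1$ whenever $u,v$ are at distance $2$ in $G$. $\lambda^d_1(G)$ is the least $\lambda$ such that $G$ admits an $L(d,1)$-labeling with labels in $\{0,1,\dots,\lambda\}$. -}

module Defs where

open import Data.Nat using (ℕ; zero; suc; _+_; _*_; _≤_; _<_; ∣_-_∣; NonZero; _%_)
open import Data.Nat.Divisibility using (_∣_)
open import Data.Fin using (Fin; toℕ)
open import Data.Integer using (ℤ; +_; -1ℤ) renaming (-_ to -ℤ_; _+_ to _+ℤ_; _*_ to _*ℤ_; _^_ to _^ℤ_)
open import Data.Integer.DivMod using (_%ℕ_)
open import Data.Product using (Σ; _,_; ∃; ∃-syntax; _×_)
open import Data.Sum using (_⊎_)
open import Relation.Binary.PropositionalEquality using (_≡_; _≢_)
open import Relation.Nullary using (¬_)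

Graph : Set → Set₁
Graph V = V → V → Set

CycAdj : (n : ℕ) .{{_ : NonZero n}} → Fin n → Fin n → Set
CycAdj n i j = (toℕ j ≡ (toℕ i + 1) % n) ⊎ (toℕ i ≡ (toℕ j + 1) % n)

-- one "forward" step of the direct graph bundle C_m ×^{σ_ℓ} C_n :
-- (i,j1) -- (i+1,j2) for i ≤ m-2 and j1j2 an edge of C_n, and
-- (m-1,j1) -- (0,σ_ℓ(j2)) for j1j2 an edge of C_n, where σ_ℓ(j) = (j+ℓ) mod n.
BundleStep : (m n ℓ : ℕ) .{{_ : NonZero n}} → Fin m × Fin n → Fin m × Fin n → Set
BundleStep m n ℓ (i₁ , j₁) (i₂ , j₂) =
  (toℕ i₁ + 1 ≡ toℕ i₂ × CycAdj n j₁ j₂)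
  ⊎ (toℕ i₁ + 1 ≡ m × toℕ i₂ ≡ 0
      × Σ (Fin n) (λ j' → CycAdj n j₁ j' × toℕ j₂ ≡ (toℕ j' + ℓ) % n))

Bundle : (m n ℓ : ℕ) .{{_ : NonZero n}} → Graph (Fin m × Fin n)
Bundle m n ℓ u v = BundleStep m n ℓ u v ⊎ BundleStep m n ℓ v u

Dist2 : {V : Set} → Graph V → V → V → Set
Dist2 G u v = u ≢ v × ¬ G u v × ∃[ w ] (G u w × G w v)

IsLd1Labeling : {V : Set} → ℕ → Graph V → ℕ → (V → ℕ) → Set
IsLd1Labeling {V} d G lam f =
  (∀ v → f v ≤ lam)
  × (∀ u v → G u v → d ≤ ∣ f u - f v ∣)
  × (∀ u v → Dist2 G u v → f u ≢ f v)

LambdaLe : {V : Set} → ℕ → Graph V → ℕ → Set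
LambdaLe {V} d G lam = ∃[ f ] IsLd1Labeling d G lam f

LambdaEq : {V : Set} → ℕ → Graph V → ℕ → Set
LambdaEq d G lam = LambdaLe d G lam × (∀ μ → μ < lam → ¬ LambdaLe d G μ)

ShiftCond : (d m n ℓ : ℕ) .{{_ : NonZero n}} → Set
ShiftCond d m n ℓ =
  (∃[ a ] ∃[ k ] ((a ≡ 1 ⊎ a ≡ 2) ×
     ℓ ≡ ((k *ℤ + s) +ℤ ((-1ℤ ^ℤ a) *ℤ + (2 * m))) %ℕ n))
  ⊎ (∃[ a ] ∃[ k ] ((a ≡ 1 ⊎ a ≡ 2) ×
     ℓ ≡ ((k *ℤ + s) +ℤ -ℤ ((-1ℤ ^ℤ a) *ℤ + ((d + 1) * m))) %ℕ n))
  where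
    s : ℕ
    s = 2 * d + 3

-- The bundle is the graph on Fin m × Fin n generated by two commuting injective steps
-- (i , j) ↦ (i + 1 , j ± 1), where leaving the last layer also applies σ_ℓ.
--
-- Upper bound: label (i , j) by (α j + β i) mod s, s = 2d + 3.  If α ℓ ≡ β m (mod s), which is
-- what the shift condition provides for a suitable (α , β), every step adds a fixed increment
-- d + c (mod s) with c ∈ {0,…,3} depending only on the direction.  Such increments keep the labels
-- of adjacent vertices at cyclic distance ≥ d; as the two increments differ and no two of them
-- sum to 0 mod s, vertices at distance two get different labels.
--
-- Lower bound: for m , n ≥ 3 the steps immerse the square grid into the bundle injectively on
-- pairs at distance two, so an L(d,1)-labeling of the bundle pulls back to the grid, and an
-- exhaustive search shows that a 13-vertex diamond of the grid has no L(d,1)-labeling with labels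
-- ≤ 2d + 1 when d ≤ 4.

module Submission where

open import Defs
open import Data.Bool using (Bool; true; false; T; not; _∧_; _∨_; if_then_else_)
open import Data.Bool.ListAction using (all; any)
open import Data.Bool.Properties using (T-∧; T-∨)
open import Data.Fin using (Fin; toℕ; fromℕ<)
open import Data.Fin.Properties using (toℕ-injective; toℕ-fromℕ<; toℕ<n)
open import Data.List using (List; []; _∷_; map; upTo)
open import Data.List.Membership.Propositional.Properties using (∈-upTo⁺)
open import Data.List.Relation.Unary.Any as Any using (satisfied)
open import Data.List.Relation.Unary.Any.Properties using (any⁺; any⁻)
open import Data.Nat
open import Data.Nat.DivMod
open import Data.Nat.Divisibility using (_∣_; ∣⇒≤)
open import Data.Nat.GeneralisedArithmetic using (fold)
open import Data.Nat.Properties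
open import Data.Nat.Tactic.RingSolver using (solve-∀; solve)
open import Data.Product using (∃-syntax; _×_; _,_; proj₁; proj₂)
open import Data.Product.Properties using (≡-dec)
open import Data.Sum using (_⊎_; inj₁; inj₂)
open import Data.Unit using (tt)
open import Function using (_∘_)
open import Function.Bundles using (Equivalence)
open import Relation.Binary.Bundles using (Setoid)
open import Relation.Binary.PropositionalEquality
open import Relation.Nullary using (¬_; contradiction; yes; no; does)
open import Relation.Nullary.Decidable
  using (isYes; isNo; True; False; toWitness; toWitnessFalse; fromWitnessFalse; dec-true; dec-false)
open Equivalence using (to; from)

labels-differ-at-common-neighbour : ∀ {V} {G : Graph V} {d lam f} → 1 ≤ d →
  IsLd1Labeling d G lam f → ∀ {u v w} → u ≢ v → G u w → G w v → f u ≢ f v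
labels-differ-at-common-neighbour {G = G} {d} {f = f} 1≤d (_ , spread , separate) {u} {v} u≢v uw wv fu≡fv =
  separate u v (u≢v , nonadjacent , _ , uw , wv) fu≡fv
  where
  ∣fu-fv∣≡0 : ∣ f u - f v ∣ ≡ 0
  ∣fu-fv∣≡0 = trans (cong (∣_- f v ∣) fu≡fv) (∣n-n∣≡0 (f v))
  nonadjacent : ¬ G u v
  nonadjacent uv = contradiction (≤-trans 1≤d (subst (d ≤_) ∣fu-fv∣≡0 (spread u v uv))) λ ()

pullback : ∀ {V W} {G : Graph V} {H : Graph W} {d lam f} (φ : V → W) →
  (∀ {u v} → G u v → H (φ u) (φ v)) → (∀ {u v} → Dist2 G u v → φ u ≢ φ v) →
  1 ≤ d → IsLd1Labeling d H lam f → LambdaLe d G lam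
pullback {f = f} φ hom separates 1≤d labeling@(bounded , spread , _) =
  f ∘ φ , bounded ∘ φ , (λ u v uv → spread _ _ (hom uv)) ,
  λ { u v dist@(_ , _ , w , uw , wv) →
        labels-differ-at-common-neighbour 1≤d labeling (separates dist) (hom uw) (hom wv) }

module Congruence (N : ℕ) .{{_ : NonZero N}} where

  infix 4 _≋_
  record _≋_ (a b : ℕ) : Set where
    constructor mod-eq
    field residues-eq : a % N ≡ b % N
  open _≋_ public

  ≋-setoid : Setoid _ _
  ≋-setoid = record
    { Carrier = ℕ
    ; _≈_ = _≋_
    ; isEquivalence = record
      { refl = mod-eq refl
      ; sym = λ (mod-eq p) → mod-eq (sym p)
      ; trans = λ (mod-eq p) (mod-eq q) → mod-eq (trans p q)
      }
    }

  open Setoid ≋-setoid public using () renaming (refl to ≋-refl; sym to ≋-sym; trans to ≋-trans)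

  ≡⇒≋ : ∀ {a b} → a ≡ b → a ≋ b
  ≡⇒≋ refl = mod-eq refl

  +-cong : ∀ {a b c e} → a ≋ b → c ≋ e → a + c ≋ b + e
  +-cong {a} {b} {c} {e} (mod-eq p) (mod-eq q) = mod-eq (begin
    (a + c) % N             ≡⟨ %-distribˡ-+ a c N ⟩
    (a % N + c % N) % N     ≡⟨ cong₂ (λ x y → (x + y) % N) p q ⟩
    (b % N + e % N) % N     ≡⟨ %-distribˡ-+ b e N ⟨
    (b + e) % N             ∎)
    where open ≡-Reasoning

  *-cong : ∀ {a b c e} → a ≋ b → c ≋ e → a * c ≋ b * e
  *-cong {a} {b} {c} {e} (mod-eq p) (mod-eq q) = mod-eq (begin
    (a * c) % N             ≡⟨ %-distribˡ-* a c N ⟩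
    (a % N * (c % N)) % N   ≡⟨ cong₂ (λ x y → (x * y) % N) p q ⟩
    (b % N * (e % N)) % N   ≡⟨ %-distribˡ-* b e N ⟨
    (b * e) % N             ∎)
    where open ≡-Reasoning

  +-congˡ : ∀ x {a b} → a ≋ b → x + a ≋ x + b
  +-congˡ x = +-cong (≋-refl {x})

  +-congʳ : ∀ x {a b} → a ≋ b → a + x ≋ b + x
  +-congʳ x p = +-cong p (≋-refl {x})

  *-congˡ : ∀ x {a b} → a ≋ b → x * a ≋ x * b
  *-congˡ x = *-cong (≋-refl {x})

  %-≋ : ∀ a → a % N ≋ a
  %-≋ a = mod-eq (m%n%n≡m%n a N)

  +-multiple-≋ : ∀ a k → a + k * N ≋ a
  +-multiple-≋ a k = mod-eq ([m+kn]%n≡m%n a k N)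

  +-cancelˡ-≋ : ∀ k a b → k + a ≋ k + b → a ≋ b
  +-cancelˡ-≋ k a b k+a≋k+b = begin
    a                     ≈⟨ +-multiple-≋ a k ⟨
    a + k * N             ≡⟨ unfold a ⟩
    (k + a) + k * pred N  ≈⟨ +-congʳ (k * pred N) k+a≋k+b ⟩
    (k + b) + k * pred N  ≡⟨ unfold b ⟨
    b + k * N             ≈⟨ +-multiple-≋ b k ⟩
    b                     ∎
    where
    open import Relation.Binary.Reasoning.Setoid ≋-setoid
    identity : ∀ x k p → x + k * suc p ≡ (k + x) + k * p
    identity = solve-∀
    unfold : ∀ x → x + k * N ≡ (k + x) + k * pred N
    unfold x = trans (cong (λ M → x + k * M) (sym (suc-pred N))) (identity x k (pred N))

  +-cancelʳ-≋ : ∀ k a b → a + k ≋ b + k → a ≋ b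
  +-cancelʳ-≋ k a b a+k≋b+k =
    +-cancelˡ-≋ k a b (≋-trans (≡⇒≋ (+-comm k a)) (≋-trans a+k≋b+k (≡⇒≋ (+-comm b k))))

  ≋⇒≡ : ∀ {a b} → a < N → b < N → a ≋ b → a ≡ b
  ≋⇒≡ a<N b<N (mod-eq p) = trans (sym (m<n⇒m%n≡m a<N)) (trans p (m<n⇒m%n≡m b<N))

∣m-[m+n]%o∣-lower : ∀ {d D s a} .{{_ : NonZero s}} → a < s → d ≤ D → d + D ≤ s →
                    d ≤ ∣ a - (a + D) % s ∣
∣m-[m+n]%o∣-lower {d} {D} {s} {a} a<s d≤D d+D≤s with a + D <? s
... | yes a+D<s = subst (d ≤_) (sym (trans (cong (∣ a -_∣) (m<n⇒m%n≡m a+D<s)) (∣m-m+n∣≡n a D))) d≤D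
... | no a+D≮s = begin
  d                     ≤⟨ m≤m+n d t ⟩
  d + t                 ≡⟨ ∣m-m+n∣≡n r (d + t) ⟨
  ∣ r - r + (d + t) ∣   ≡⟨ ∣-∣-comm r _ ⟩
  ∣ r + (d + t) - r ∣   ≡⟨ cong₂ ∣_-_∣ a≡ r≡ ⟨
  ∣ a - (a + D) % s ∣   ∎
  where
  open ≤-Reasoning
  t r : ℕ
  t = s ∸ (d + D)
  r = a + D ∸ s
  a≡ : a ≡ r + (d + t)
  a≡ = +-cancelʳ-≡ D a (r + (d + t)) (begin-equality
    a + D               ≡⟨ m+[n∸m]≡n (≮⇒≥ a+D≮s) ⟨
    s + r               ≡⟨ cong (_+ r) (m+[n∸m]≡n d+D≤s) ⟨
    d + D + t + r       ≡⟨ rearrange d D t r ⟩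
    r + (d + t) + D     ∎)
    where
    rearrange : ∀ d D t r → d + D + t + r ≡ r + (d + t) + D
    rearrange = solve-∀
  r≡ : (a + D) % s ≡ r
  r≡ = begin-equality
    (a + D) % s         ≡⟨ cong (_% s) (trans (+-comm r s) (m+[n∸m]≡n (≮⇒≥ a+D≮s))) ⟨
    (r + s) % s         ≡⟨ [m+n]%n≡m%n r s ⟩
    r % s               ≡⟨ m<n⇒m%n≡m (≤-<-trans (subst (r ≤_) (sym a≡) (m≤m+n r _)) a<s) ⟩
    r                   ∎

-- The square grid

Point : Set
Point = ℕ × ℕ

data Grid : Graph Point where
  east  : ∀ {a b} → Grid (a , b) (suc a , b)
  west  : ∀ {a b} → Grid (suc a , b) (a , b)
  north : ∀ {a b} → Grid (a , b) (a , suc b)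
  south : ∀ {a b} → Grid (a , suc b) (a , b)

∣-∣≡1⇒adjacent : ∀ x y → ∣ x - y ∣ ≡ 1 → y ≡ suc x ⊎ x ≡ suc y
∣-∣≡1⇒adjacent zero    (suc zero) _  = inj₁ refl
∣-∣≡1⇒adjacent (suc zero) zero    _  = inj₂ refl
∣-∣≡1⇒adjacent (suc x) (suc y)    eq with ∣-∣≡1⇒adjacent x y eq
... | inj₁ refl = inj₁ refl
... | inj₂ refl = inj₂ refl

axialᵇ : ℕ → ℕ → ℕ → ℕ → Bool
axialᵇ x y u v = isYes (x ≟ y) ∧ isYes (∣ u - v ∣ ≟ 1)

axialᵇ-sound : ∀ x y u v → T (axialᵇ x y u v) → x ≡ y × (v ≡ suc u ⊎ u ≡ suc v)
axialᵇ-sound x y u v h with T-∧ .to h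
... | x≡y , gap = toWitness {a? = x ≟ y} x≡y , ∣-∣≡1⇒adjacent u v (toWitness {a? = ∣ u - v ∣ ≟ 1} gap)

adjᵇ : Point → Point → Bool
adjᵇ (a , b) (c , e) = axialᵇ a c b e ∨ axialᵇ b e a c

adjᵇ-sound : ∀ p q → T (adjᵇ p q) → Grid p q
adjᵇ-sound (a , b) (c , e) h with T-∨ .to h
... | inj₁ h₁ with axialᵇ-sound a c b e h₁
...   | refl , inj₁ refl = north
...   | refl , inj₂ refl = south
adjᵇ-sound (a , b) (c , e) h | inj₂ h₂ with axialᵇ-sound b e a c h₂
...   | refl , inj₁ refl = east
...   | refl , inj₂ refl = west

-- For a coordinate 0, pred yields p itself, which adjᵇ then rejects.
around : Point → List Point
around (a , b) = (suc a , b) ∷ (pred a , b) ∷ (a , suc b) ∷ (a , pred b) ∷ []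

apartᵇ : Point → Point → Bool
apartᵇ p q = isNo (≡-dec _≟_ _≟_ p q) ∧ any (λ w → adjᵇ p w ∧ adjᵇ w q) (around p)

apartᵇ-sound : ∀ p q → T (apartᵇ p q) → p ≢ q × ∃[ w ] (Grid p w × Grid w q)
apartᵇ-sound p q h with T-∧ .to h
... | p≢q , common with satisfied (any⁻ _ (around p) common)
...   | w , pw∧wq =
  toWitnessFalse p≢q , w , adjᵇ-sound p w (T-∧ .to pw∧wq .proj₁) , adjᵇ-sound w q (T-∧ .to pw∧wq .proj₂)

-- The cheap test on labels comes first, so that the grid geometry is evaluated only when it matters.
fits : ℕ → List (Point × ℕ) → Point → ℕ → Bool
fits d σ p x =
  all (λ { (q , y) → ((d ≤ᵇ ∣ y - x ∣) ∨ not (adjᵇ q p)) ∧ (isNo (y ≟ x) ∨ not (apartᵇ q p)) }) σ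

labelable : ℕ → ℕ → List Point → List (Point × ℕ) → Bool
labelable d L [] σ = true
labelable d L (p ∷ ps) σ = any (λ x → fits d σ p x ∧ labelable d L ps ((p , x) ∷ σ)) (upTo (suc L))

T-∨-not : ∀ {a} b → (T b → T a) → T (a ∨ not b)
T-∨-not {true}  b     _ = tt
T-∨-not {false} true  h = h tt
T-∨-not {false} false _ = tt

module _ (d L : ℕ) (h : Point → ℕ) (bounded : ∀ p → h p ≤ L)
         (spread : ∀ {p q} → Grid p q → d ≤ ∣ h p - h q ∣)
         (separated : ∀ {p q w} → p ≢ q → Grid p w → Grid w q → h p ≢ h q) where

  graph : List Point → List (Point × ℕ)
  graph = map (λ q → q , h q)

  fits-graph : ∀ p qs → T (fits d (graph qs) p (h p))
  fits-graph p [] = tt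
  fits-graph p (q ∷ qs) = T-∧ .from (T-∧ .from (edge , distance-two) , fits-graph p qs)
    where
    edge : T ((d ≤ᵇ ∣ h q - h p ∣) ∨ not (adjᵇ q p))
    edge = T-∨-not (adjᵇ q p) (≤⇒≤ᵇ ∘ spread ∘ adjᵇ-sound q p)
    distance-two : T (isNo (h q ≟ h p) ∨ not (apartᵇ q p))
    distance-two = T-∨-not (apartᵇ q p) λ apart →
      let q≢p , w , qw , wp = apartᵇ-sound q p apart in fromWitnessFalse (separated q≢p qw wp)

  labelable-graph : ∀ ps qs → T (labelable d L ps (graph qs))
  labelable-graph [] qs = tt
  labelable-graph (p ∷ ps) qs = any⁺ _ (Any.map (λ { refl → extend }) (∈-upTo⁺ (s≤s (bounded p))))
    where
    extend : T (fits d (graph qs) p (h p) ∧ labelable d L ps (graph (p ∷ qs)))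
    extend = T-∧ .from (fits-graph p qs , labelable-graph ps (p ∷ qs))

diamond : List Point
diamond = (2 , 2) ∷ (1 , 2) ∷ (2 , 1) ∷ (1 , 1) ∷ (3 , 2) ∷ (3 , 1) ∷ (2 , 3) ∷ (1 , 3) ∷ (3 , 3)
        ∷ (0 , 2) ∷ (2 , 0) ∷ (4 , 2) ∷ (2 , 4) ∷ []

-- Each absurd pattern below is accepted by evaluating the exhaustive search.
diamond-unlabelable : ∀ d → 1 ≤ d → d ≤ 4 → ¬ T (labelable d (2 * d + 1) diamond [])
diamond-unlabelable 1 _ _ ()
diamond-unlabelable 2 _ _ ()
diamond-unlabelable 3 _ _ ()
diamond-unlabelable 4 _ _ ()
diamond-unlabelable (suc (suc (suc (suc (suc _))))) _ (s≤s (s≤s (s≤s (s≤s ()))))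

grid-lower-bound : ∀ d → 1 ≤ d → d ≤ 4 → ∀ μ → μ < 2 * d + 2 → ¬ LambdaLe d Grid μ
grid-lower-bound d 1≤d d≤4 μ μ<2d+2 (f , bounded , spread , separate) =
  diamond-unlabelable d 1≤d d≤4 (labelable-graph d (2 * d + 1) f bounded′ (spread _ _)
    (labels-differ-at-common-neighbour 1≤d (bounded , spread , separate)) diamond [])
  where
  bounded′ : ∀ p → f p ≤ 2 * d + 1
  bounded′ p = ≤-trans (bounded p) (s≤s⁻¹ (subst (μ <_) (+-suc (2 * d) 1) μ<2d+2))

-- Graphs generated by two commuting steps

data Dir : Set where
  up down : Dir

module GridImmersion {V : Set} (G : Graph V) (G-sym : ∀ {u v} → G u v → G v u)
  (step : Dir → V → V) (step-adjacent : ∀ e u → G u (step e u))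
  (step-comm : ∀ u → step up (step down u) ≡ step down (step up u))
  (up≢down : ∀ u → step up u ≢ step down u)
  (no-return : ∀ e e′ u → step e′ (step e u) ≢ u)
  (origin : V) where

  embed : Point → V
  embed (a , b) = fold (fold origin (step down) b) (step up) a

  embed-north : ∀ a b → embed (a , suc b) ≡ step down (embed (a , b))
  embed-north zero    b = refl
  embed-north (suc a) b = trans (cong (step up) (embed-north a b)) (step-comm _)

  embed-homomorphism : ∀ {p q} → Grid p q → G (embed p) (embed q)
  embed-homomorphism east            = step-adjacent up _
  embed-homomorphism west            = G-sym (step-adjacent up _)
  embed-homomorphism (north {a} {b}) = subst (G _) (sym (embed-north a b)) (step-adjacent down _)
  embed-homomorphism (south {a} {b}) = G-sym (subst (G _) (sym (embed-north a b)) (step-adjacent down _))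

  private
    returns : ∀ {x y} e e′ → y ≡ step e′ (step e x) → x ≢ y
    returns e e′ y≡ x≡y = no-return e e′ _ (trans (sym y≡) (sym x≡y))

    siblings : ∀ {x y} z → x ≡ step down z → y ≡ step up z → x ≢ y
    siblings z x≡ y≡ x≡y = up≢down z (trans (sym y≡) (trans (sym x≡y) x≡))

  -- Two grid points at distance two are either two steps apart or the two successors of one point.
  embed-separates : ∀ {p q} → Dist2 Grid p q → embed p ≢ embed q
  embed-separates (p≢q , _ , _ , east , west)   = contradiction refl p≢q
  embed-separates (p≢q , _ , _ , west , east)   = contradiction refl p≢q
  embed-separates (p≢q , _ , _ , north , south) = contradiction refl p≢q
  embed-separates (p≢q , _ , _ , south , north) = contradiction refl p≢q
  embed-separates (_ , _ , _ , east , east) = returns up up refl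
  embed-separates (_ , _ , _ , west , west) = ≢-sym (returns up up refl)
  embed-separates (_ , _ , _ , east {a} , north {b = b}) = returns up down (embed-north (suc a) b)
  embed-separates (_ , _ , _ , south {b = b} , west {a}) = ≢-sym (returns up down (embed-north (suc a) b))
  embed-separates (_ , _ , _ , north {a} {b} , east) = returns down up (cong (step up) (embed-north a b))
  embed-separates (_ , _ , _ , west {a} , south {b = b}) = ≢-sym (returns down up (cong (step up) (embed-north a b)))
  embed-separates (_ , _ , _ , north {a} {b} , north) =
    returns down down (trans (embed-north a (suc b)) (cong (step down) (embed-north a b)))
  embed-separates (_ , _ , _ , south {a} , south {b = b}) =
    ≢-sym (returns down down (trans (embed-north a (suc b)) (cong (step down) (embed-north a b))))
  embed-separates (_ , _ , _ , east {a} , south {b = b}) = siblings (embed (a , b)) (embed-north a b) refl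
  embed-separates (_ , _ , _ , south {a} {b} , east) = siblings (embed (a , b)) (embed-north a b) refl
  embed-separates (_ , _ , _ , west {a} {b} , north) = ≢-sym (siblings (embed (a , b)) (embed-north a b) refl)
  embed-separates (_ , _ , _ , north {b = b} , west {a}) = ≢-sym (siblings (embed (a , b)) (embed-north a b) refl)

module IncrementLabeling {V : Set} (G : Graph V) (step : Dir → V → V)
  (edge⇒step : ∀ {u v} → G u v → ∃[ e ] (v ≡ step e u ⊎ u ≡ step e v))
  (step-injective : ∀ e {u v} → step e u ≡ step e v → u ≡ v)
  (d s : ℕ) .{{_ : NonZero s}} (D : Dir → ℕ)
  (D-spread : ∀ e → d ≤ D e × d + D e ≤ s)
  (D-injective : ∀ e e′ → D e % s ≡ D e′ % s → e ≡ e′)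
  (D-no-cancel : ∀ e e′ → (D e + D e′) % s ≢ 0)
  (f : V → ℕ) (f<s : ∀ u → f u < s) (f-step : ∀ e u → f (step e u) ≡ (f u + D e) % s) where

  open Congruence s

  increment-injective : ∀ x e e′ → (x + D e) % s ≡ (x + D e′) % s → e ≡ e′
  increment-injective x e e′ eq = D-injective e e′ (residues-eq (+-cancelˡ-≋ x (D e) (D e′) (mod-eq eq)))

  labels-differ-after-two-steps : ∀ e e′ u → f (step e′ (step e u)) ≢ f u
  labels-differ-after-two-steps e e′ u eq = D-no-cancel e e′ (trans (residues-eq (+-cancelˡ-≋ (f u) _ 0 (begin
    f u + (D e + D e′)           ≡⟨ +-assoc (f u) (D e) (D e′) ⟨
    f u + D e + D e′             ≈⟨ +-congʳ (D e′) (%-≋ _) ⟨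
    (f u + D e) % s + D e′       ≡⟨ cong (_+ D e′) (f-step e u) ⟨
    f (step e u) + D e′          ≈⟨ %-≋ _ ⟨
    (f (step e u) + D e′) % s    ≡⟨ f-step e′ _ ⟨
    f (step e′ (step e u))       ≡⟨ eq ⟩
    f u                          ≡⟨ +-identityʳ (f u) ⟨
    f u + 0                      ∎))) (m*n%n≡0 0 s))
    where open import Relation.Binary.Reasoning.Setoid ≋-setoid

  step-spread : ∀ e u → d ≤ ∣ f u - f (step e u) ∣
  step-spread e u = subst (λ x → d ≤ ∣ f u - x ∣) (sym (f-step e u))
    (∣m-[m+n]%o∣-lower (f<s u) (proj₁ (D-spread e)) (proj₂ (D-spread e)))

  labeling : IsLd1Labeling d G (pred s) f
  labeling = (λ u → <⇒≤pred (f<s u)) , spread , separate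
    where
    spread : ∀ u v → G u v → d ≤ ∣ f u - f v ∣
    spread u v uv with edge⇒step uv
    ... | e , inj₁ refl = step-spread e u
    ... | e , inj₂ refl = subst (d ≤_) (∣-∣-comm (f v) (f (step e v))) (step-spread e v)

    separate : ∀ u v → Dist2 G u v → f u ≢ f v
    separate u v (u≢v , _ , w , uw , wv) fu≡fv with edge⇒step uw | edge⇒step wv
    ... | e , inj₁ refl | e′ , inj₁ refl = labels-differ-after-two-steps e e′ u (sym fu≡fv)
    ... | e , inj₂ refl | e′ , inj₂ refl = labels-differ-after-two-steps e′ e v fu≡fv
    ... | e , inj₂ refl | e′ , inj₁ refl = u≢v (cong (λ e → step e w) e≡e′)
      where
      e≡e′ : e ≡ e′
      e≡e′ = increment-injective (f w) e e′ (trans (sym (f-step e w)) (trans fu≡fv (f-step e′ w)))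
    ... | e , inj₁ refl | e′ , inj₂ w≡ = u≢v (step-injective e (trans w≡ (cong (λ e → step e v) (sym e≡e′))))
      where
      e≡e′ : e ≡ e′
      e≡e′ = increment-injective (f u) e e′ (begin-equality
        (f u + D e) % s   ≡⟨ f-step e u ⟨
        f (step e u)      ≡⟨ cong f w≡ ⟩
        f (step e′ v)     ≡⟨ f-step e′ v ⟩
        (f v + D e′) % s  ≡⟨ cong (λ x → (x + D e′) % s) fu≡fv ⟨
        (f u + D e′) % s  ∎)
        where open ≤-Reasoning

-- The direct graph bundle

module BundleSteps (m n ℓ : ℕ) .{{_ : NonZero m}} .{{_ : NonZero n}} where

  Vertex : Set
  Vertex = Fin m × Fin n

  next : Fin m → Fin m
  next i = fromℕ< (m%n<n (toℕ i + 1) m)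

  rotate : ℕ → Fin n → Fin n
  rotate k j = fromℕ< (m%n<n (toℕ j + k) n)

  twist : Fin m → ℕ
  twist i = if does (toℕ i + 1 ≟ m) then ℓ else 0

  offset : Dir → ℕ
  offset up   = 1
  offset down = pred n

  step : Dir → Vertex → Vertex
  step e (i , j) = next i , rotate (twist i) (rotate (offset e) j)

  private module ModN = Congruence n
  private module ModM = Congruence m

  next-inner : ∀ {i} → toℕ i + 1 ≢ m → toℕ (next i) ≡ toℕ i + 1
  next-inner {i} i+1≢m = trans (toℕ-fromℕ< _)
    (m<n⇒m%n≡m (≤∧≢⇒< (subst (_≤ m) (+-comm 1 (toℕ i)) (toℕ<n i)) i+1≢m))

  next-last : ∀ {i} → toℕ i + 1 ≡ m → toℕ (next i) ≡ 0
  next-last {i} i+1≡m = trans (toℕ-fromℕ< _) (trans (cong (_% m) i+1≡m) (n%n≡0 m))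

  twist-inner : ∀ {i} → toℕ i + 1 ≢ m → twist i ≡ 0
  twist-inner {i} i+1≢m = cong (if_then ℓ else 0) (dec-false (toℕ i + 1 ≟ m) i+1≢m)

  twist-last : ∀ {i} → toℕ i + 1 ≡ m → twist i ≡ ℓ
  twist-last {i} i+1≡m = cong (if_then ℓ else 0) (dec-true (toℕ i + 1 ≟ m) i+1≡m)

  toℕ-rotate : ∀ k j → toℕ (rotate k j) ≡ (toℕ j + k) % n
  toℕ-rotate k j = toℕ-fromℕ< _

  rotate-+ : ∀ a b j → rotate a (rotate b j) ≡ rotate (b + a) j
  rotate-+ a b j = toℕ-injective (begin
    toℕ (rotate a (rotate b j))     ≡⟨ toℕ-rotate a _ ⟩
    (toℕ (rotate b j) + a) % n      ≡⟨ cong (λ x → (x + a) % n) (toℕ-rotate b j) ⟩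
    ((toℕ j + b) % n + a) % n       ≡⟨ ModN.residues-eq (ModN.+-congʳ a (ModN.%-≋ _)) ⟩
    (toℕ j + b + a) % n             ≡⟨ cong (_% n) (+-assoc (toℕ j) b a) ⟩
    (toℕ j + (b + a)) % n           ≡⟨ toℕ-rotate (b + a) j ⟨
    toℕ (rotate (b + a) j)          ∎)
    where open ≡-Reasoning

  rotate-zero : ∀ j → rotate 0 j ≡ j
  rotate-zero j = toℕ-injective (begin
    toℕ (rotate 0 j)   ≡⟨ toℕ-rotate 0 j ⟩
    (toℕ j + 0) % n    ≡⟨ cong (_% n) (+-identityʳ (toℕ j)) ⟩
    toℕ j % n          ≡⟨ m<n⇒m%n≡m (toℕ<n j) ⟩
    toℕ j              ∎)
    where open ≡-Reasoning

  rotate-inverse : ∀ a b j → b + a ≡ n → rotate a (rotate b j) ≡ j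
  rotate-inverse a b j b+a≡n = toℕ-injective (begin
    toℕ (rotate a (rotate b j))   ≡⟨ cong toℕ (rotate-+ a b j) ⟩
    toℕ (rotate (b + a) j)        ≡⟨ toℕ-rotate (b + a) j ⟩
    (toℕ j + (b + a)) % n         ≡⟨ cong (λ k → (toℕ j + k) % n) b+a≡n ⟩
    (toℕ j + n) % n               ≡⟨ [m+n]%n≡m%n (toℕ j) n ⟩
    toℕ j % n                     ≡⟨ m<n⇒m%n≡m (toℕ<n j) ⟩
    toℕ j                         ∎)
    where open ≡-Reasoning

  rotate-injective : ∀ k {j j′} → rotate k j ≡ rotate k j′ → j ≡ j′
  rotate-injective k {j} {j′} eq =
    toℕ-injective (ModN.≋⇒≡ (toℕ<n j) (toℕ<n j′) (ModN.+-cancelʳ-≋ k _ _ (ModN.mod-eq residues)))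
    where
    residues : (toℕ j + k) % n ≡ (toℕ j′ + k) % n
    residues = trans (sym (toℕ-rotate k j)) (trans (cong toℕ eq) (toℕ-rotate k j′))

  rotate-adjacent : ∀ e j → CycAdj n j (rotate (offset e) j)
  rotate-adjacent up   j = inj₁ (toℕ-rotate 1 j)
  rotate-adjacent down j = inj₂ (trans (cong toℕ (sym back)) (toℕ-rotate 1 _))
    where
    back : rotate 1 (rotate (pred n) j) ≡ j
    back = rotate-inverse 1 (pred n) j (trans (+-comm (pred n) 1) (suc-pred n))

  adjacent⇒rotate : ∀ {j j′} → CycAdj n j j′ → ∃[ e ] j′ ≡ rotate (offset e) j
  adjacent⇒rotate {j} (inj₁ j′≡) = up , toℕ-injective (trans j′≡ (sym (toℕ-rotate 1 j)))
  adjacent⇒rotate {j} {j′} (inj₂ j≡) = down , (begin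
    j′                            ≡⟨ rotate-inverse (pred n) 1 j′ (suc-pred n) ⟨
    rotate (pred n) (rotate 1 j′) ≡⟨ cong (rotate (pred n)) (toℕ-injective (trans (toℕ-rotate 1 j′) (sym j≡))) ⟩
    rotate (pred n) j             ∎)
    where open ≡-Reasoning

  rotate-twist-inner : ∀ {i} → toℕ i + 1 ≢ m → ∀ j → rotate (twist i) j ≡ j
  rotate-twist-inner inner j = trans (cong (λ k → rotate k j) (twist-inner inner)) (rotate-zero j)

  toℕ-rotate-twist-last : ∀ {i} → toℕ i + 1 ≡ m → ∀ j → toℕ (rotate (twist i) j) ≡ (toℕ j + ℓ) % n
  toℕ-rotate-twist-last last j = trans (cong (λ k → toℕ (rotate k j)) (twist-last last)) (toℕ-rotate ℓ j)

  step-adjacent : ∀ e u → BundleStep m n ℓ u (step e u)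
  step-adjacent e (i , j) with toℕ i + 1 ≟ m
  ... | no inner = inj₁ (sym (next-inner inner) ,
          subst (CycAdj n j) (sym (rotate-twist-inner inner _)) (rotate-adjacent e j))
  ... | yes last = inj₂ (last , next-last last , rotate (offset e) j , rotate-adjacent e j ,
          toℕ-rotate-twist-last last _)

  BundleStep⇒step : ∀ {u w} → BundleStep m n ℓ u w → ∃[ e ] w ≡ step e u
  BundleStep⇒step {i , j} {i′ , j′} (inj₁ (i+1≡i′ , adj)) with adjacent⇒rotate adj
  ... | e , j′≡ = e , cong₂ _,_ (toℕ-injective (trans (sym i+1≡i′) (sym (next-inner inner))))
                        (trans j′≡ (sym (rotate-twist-inner inner _)))
    where
    inner : toℕ i + 1 ≢ m
    inner i+1≡m = <-irrefl (trans (sym i+1≡i′) i+1≡m) (toℕ<n i′)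
  BundleStep⇒step {i , j} {i′ , j′} (inj₂ (last , i′≡0 , _ , adj , j′≡)) with adjacent⇒rotate adj
  ... | e , refl = e , cong₂ _,_ (toℕ-injective (trans i′≡0 (sym (next-last last))))
                         (toℕ-injective (trans j′≡ (sym (toℕ-rotate-twist-last last _))))

  toℕ-next-≋ : ∀ i → toℕ (next i) ModM.≋ toℕ i + 1
  toℕ-next-≋ i = ModM.≋-trans (ModM.≡⇒≋ (toℕ-fromℕ< _)) (ModM.%-≋ _)

  step-injective : ∀ e {u v} → step e u ≡ step e v → u ≡ v
  step-injective e {i , j} {i′ , j′} eq with next-injective (cong proj₁ eq)
    where
    next-injective : next i ≡ next i′ → i ≡ i′
    next-injective next≡ = toℕ-injective (ModM.≋⇒≡ (toℕ<n i) (toℕ<n i′) (ModM.+-cancelʳ-≋ 1 _ _ (begin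
      toℕ i + 1         ≈⟨ toℕ-next-≋ i ⟨
      toℕ (next i)      ≡⟨ cong toℕ next≡ ⟩
      toℕ (next i′)     ≈⟨ toℕ-next-≋ i′ ⟩
      toℕ i′ + 1        ∎)))
      where open import Relation.Binary.Reasoning.Setoid ModM.≋-setoid
  ... | refl = cong (i ,_) (rotate-injective (offset e) (rotate-injective (twist i) (cong proj₂ eq)))

  rotate-+₃ : ∀ a b c j → rotate c (rotate b (rotate a j)) ≡ rotate (a + b + c) j
  rotate-+₃ a b c j = trans (cong (rotate c) (rotate-+ b a j)) (rotate-+ c (a + b) j)

  step-comm : ∀ e e′ u → step e (step e′ u) ≡ step e′ (step e u)
  step-comm e e′ (i , j) = cong (λ x → next (next i) , rotate (twist (next i)) x) (begin
    rotate (offset e) (rotate (twist i) (rotate (offset e′) j))  ≡⟨ rotate-+₃ (offset e′) (twist i) (offset e) j ⟩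
    rotate (offset e′ + twist i + offset e) j                    ≡⟨ cong (λ k → rotate k j) exchange ⟩
    rotate (offset e + twist i + offset e′) j                    ≡⟨ rotate-+₃ (offset e) (twist i) (offset e′) j ⟨
    rotate (offset e′) (rotate (twist i) (rotate (offset e) j))  ∎)
    where
    open ≡-Reasoning
    commute : ∀ a t b → a + t + b ≡ b + t + a
    commute = solve-∀
    exchange : offset e′ + twist i + offset e ≡ offset e + twist i + offset e′
    exchange = commute (offset e′) (twist i) (offset e)

  up≢down : 3 ≤ n → ∀ u → step up u ≢ step down u
  up≢down 3≤n (i , j) eq = contradiction (begin
    3             ≤⟨ 3≤n ⟩
    n             ≡⟨ suc-pred n ⟨
    suc (pred n)  ≡⟨ cong suc 1≡pred-n ⟨
    2             ∎) λ { (s≤s (s≤s ())) }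
    where
    open ≤-Reasoning
    rotations-equal : rotate 1 j ≡ rotate (pred n) j
    rotations-equal = rotate-injective (twist i) (cong proj₂ eq)
    residues : (toℕ j + 1) % n ≡ (toℕ j + pred n) % n
    residues = trans (sym (toℕ-rotate 1 j)) (trans (cong toℕ rotations-equal) (toℕ-rotate (pred n) j))
    1≡pred-n : 1 ≡ pred n
    1≡pred-n = ModN.≋⇒≡ (≤-trans (s≤s (s≤s z≤n)) 3≤n) (subst (pred n <_) (suc-pred n) (n<1+n (pred n)))
      (ModN.+-cancelˡ-≋ (toℕ j) 1 (pred n) (ModN.mod-eq residues))

  no-return : 3 ≤ m → ∀ e e′ u → step e′ (step e u) ≢ u
  no-return 3≤m e e′ (i , j) eq = contradiction 2≡0 λ ()
    where
    open import Relation.Binary.Reasoning.Setoid ModM.≋-setoid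
    rearrange : ∀ x → 2 + x ≡ x + 1 + 1
    rearrange = solve-∀
    2≡0 : 2 ≡ 0
    2≡0 = ModM.≋⇒≡ (≤-trans (s≤s (s≤s (s≤s z≤n))) 3≤m) (≤-trans (s≤s z≤n) 3≤m)
      (ModM.+-cancelʳ-≋ (toℕ i) 2 0 (begin
      2 + toℕ i                 ≡⟨ rearrange (toℕ i) ⟩
      toℕ i + 1 + 1             ≈⟨ ModM.+-congʳ 1 (toℕ-next-≋ i) ⟨
      toℕ (next i) + 1          ≈⟨ toℕ-next-≋ (next i) ⟨
      toℕ (next (next i))       ≡⟨ cong (toℕ ∘ proj₁) eq ⟩
      toℕ i                     ∎))

  bundle⇒step : ∀ {u v} → Bundle m n ℓ u v → ∃[ e ] (v ≡ step e u ⊎ u ≡ step e v)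
  bundle⇒step (inj₁ uv) = let e , v≡ = BundleStep⇒step uv in e , inj₁ v≡
  bundle⇒step (inj₂ vu) = let e , u≡ = BundleStep⇒step vu in e , inj₂ u≡

-- Diagonal labelings and the shift condition

module DiagonalLabeling (m n ℓ : ℕ) .{{_ : NonZero m}} .{{_ : NonZero n}}
  {s : ℕ} .{{_ : NonZero s}} (s∣n : s ∣ n) where
  open BundleSteps m n ℓ
  open Congruence s
  open import Relation.Binary.Reasoning.Setoid ≋-setoid

  toℕ-rotate-≋ : ∀ k j → toℕ (rotate k j) ≋ toℕ j + k
  toℕ-rotate-≋ k j = mod-eq (trans (cong (_% s) (toℕ-rotate k j)) (m∣n⇒o%n%m≡o%m s n _ s∣n))

  module _ (α β : ℕ) (twist-compatible : α * ℓ ≋ β * m) where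

    weight : Vertex → ℕ
    weight (i , j) = α * toℕ j + β * toℕ i

    wrap-compatible : ∀ i → α * twist i + β * toℕ (next i) ≋ β * (toℕ i + 1)
    wrap-compatible i with toℕ i + 1 ≟ m
    ... | yes last = begin
      α * twist i + β * toℕ (next i)  ≡⟨ cong₂ (λ t r → α * t + β * r) (twist-last last) (next-last last) ⟩
      α * ℓ + β * 0                   ≡⟨ cong (α * ℓ +_) (*-zeroʳ β) ⟩
      α * ℓ + 0                       ≡⟨ +-identityʳ (α * ℓ) ⟩
      α * ℓ                           ≈⟨ twist-compatible ⟩
      β * m                           ≡⟨ cong (β *_) last ⟨
      β * (toℕ i + 1)                 ∎
    ... | no inner = begin
      α * twist i + β * toℕ (next i)  ≡⟨ cong₂ (λ t r → α * t + β * r) (twist-inner inner) (next-inner inner) ⟩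
      α * 0 + β * (toℕ i + 1)         ≡⟨ cong (_+ β * (toℕ i + 1)) (*-zeroʳ α) ⟩
      β * (toℕ i + 1)                 ∎

    weight-step : ∀ e u → weight (step e u) ≋ weight u + (α * offset e + β)
    weight-step e (i , j) = begin
      α * toℕ (rotate t (rotate δ j)) + β * toℕ (next i)
        ≈⟨ +-congʳ (β * toℕ (next i)) (*-congˡ α rotations) ⟩
      α * (toℕ j + δ + t) + β * toℕ (next i)
        ≡⟨ expand α (toℕ j) δ t (β * toℕ (next i)) ⟩
      (α * toℕ j + α * δ) + (α * t + β * toℕ (next i))
        ≈⟨ +-congˡ (α * toℕ j + α * δ) (wrap-compatible i) ⟩
      (α * toℕ j + α * δ) + β * (toℕ i + 1)
        ≡⟨ collect α (toℕ j) δ β (toℕ i) ⟩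
      weight (i , j) + (α * δ + β)
        ∎
      where
      t δ : ℕ
      t = twist i
      δ = offset e
      rotations : toℕ (rotate t (rotate δ j)) ≋ toℕ j + δ + t
      rotations = ≋-trans (toℕ-rotate-≋ t _) (+-congʳ t (toℕ-rotate-≋ δ j))
      expand : ∀ a j δ t r → a * (j + δ + t) + r ≡ (a * j + a * δ) + (a * t + r)
      expand = solve-∀
      collect : ∀ a j δ b i → (a * j + a * δ) + b * (i + 1) ≡ (a * j + b * i) + (a * δ + b)
      collect = solve-∀

    module _ (d : ℕ) (D : Dir → ℕ) (up-≋ : α + β ≋ D up) (down-≋ : β ≋ α + D down)
      (D-spread : ∀ e → d ≤ D e × d + D e ≤ s)
      (D-injective : ∀ e e′ → D e % s ≡ D e′ % s → e ≡ e′)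
      (D-no-cancel : ∀ e e′ → (D e + D e′) % s ≢ 0) where

      offset-≋ : ∀ e → α * offset e + β ≋ D e
      offset-≋ up = ≋-trans (≡⇒≋ (cong (_+ β) (*-identityʳ α))) up-≋
      offset-≋ down = begin
        α * pred n + β               ≈⟨ +-congˡ (α * pred n) down-≋ ⟩
        α * pred n + (α + D down)    ≡⟨ regroup α (pred n) (D down) ⟩
        D down + α * suc (pred n)    ≡⟨ cong (λ k → D down + α * k) (trans (suc-pred n) n≡qs) ⟩
        D down + α * (q * s)         ≡⟨ cong (D down +_) (*-assoc α q s) ⟨
        D down + α * q * s           ≈⟨ +-multiple-≋ (D down) (α * q) ⟩
        D down                       ∎
        where
        open _∣_ s∣n renaming (quotient to q; equality to n≡qs)
        regroup : ∀ a p D → a * p + (a + D) ≡ D + a * suc p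
        regroup = solve-∀

      labeling : LambdaLe d (Bundle m n ℓ) (pred s)
      labeling = f , IncrementLabeling.labeling (Bundle m n ℓ) step bundle⇒step step-injective
        d s D D-spread D-injective D-no-cancel f (λ u → m%n<n (weight u) s)
        (λ e u → residues-eq (f-step e u))
        where
        f : Vertex → ℕ
        f u = weight u % s
        f-step : ∀ e u → weight (step e u) ≋ f u + D e
        f-step e u = begin
          weight (step e u)               ≈⟨ weight-step e u ⟩
          weight u + (α * offset e + β)   ≈⟨ +-congˡ (weight u) (offset-≋ e) ⟩
          weight u + D e                  ≈⟨ +-congʳ (D e) (%-≋ (weight u)) ⟨
          f u + D e                       ∎

module IntegerResidues where
  open import Data.Integer using (ℤ; +_; -[1+_]) renaming (_+_ to _+ℤ_; _*_ to _*ℤ_; -_ to -ℤ_; _-_ to _-ℤ_)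
  import Data.Integer.Properties as ℤP
  open import Data.Integer.DivMod using (_%ℕ_; _/ℕ_; a≡a%ℕn+[a/ℕn]*n)
  open import Data.Integer.Tactic.RingSolver renaming (solve-∀ to solveℤ-∀)

  [ks+c]%ℕn≡c+Ks : ∀ {n s} .{{_ : NonZero n}} → s ∣ n →
                   ∀ ℓ k c → ℓ ≡ (k *ℤ + s +ℤ c) %ℕ n → ∃[ K ] (+ ℓ ≡ c +ℤ K *ℤ + s)
  [ks+c]%ℕn≡c+Ks {n} {s} s∣n ℓ k c ℓ≡ = k -ℤ Q *ℤ + q , (begin
    + ℓ                                   ≡⟨ cong +_ ℓ≡ ⟩
    + (z %ℕ n)                            ≡⟨ shift (+ (z %ℕ n)) Q (+ n) ⟩
    + (z %ℕ n) +ℤ Q *ℤ + n -ℤ Q *ℤ + n ≡⟨ cong (_-ℤ Q *ℤ + n) (a≡a%ℕn+[a/ℕn]*n z n) ⟨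
    z -ℤ Q *ℤ + n                       ≡⟨ cong (λ x → z -ℤ Q *ℤ x) (trans (cong +_ n≡qs) (ℤP.pos-* q s)) ⟩
    z -ℤ Q *ℤ (+ q *ℤ + s)             ≡⟨ regroup k (+ s) c Q (+ q) ⟩
    c +ℤ (k -ℤ Q *ℤ + q) *ℤ + s       ∎)
    where
    open ≡-Reasoning
    open _∣_ s∣n renaming (quotient to q; equality to n≡qs)
    z Q : ℤ
    z = k *ℤ + s +ℤ c
    Q = z /ℕ n
    shift : ∀ r Q N → r ≡ r +ℤ Q *ℤ N -ℤ Q *ℤ N
    shift = solveℤ-∀
    regroup : ∀ k s c Q q → k *ℤ s +ℤ c -ℤ Q *ℤ (q *ℤ s) ≡ c +ℤ (k -ℤ Q *ℤ q) *ℤ s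
    regroup = solveℤ-∀

  module _ {s : ℕ} .{{_ : NonZero s}} where
    open Congruence s

    +a≡+b+Ks⇒a≋b : ∀ a b K → + a ≡ + b +ℤ K *ℤ + s → a ≋ b
    +a≡+b+Ks⇒a≋b a b (+ k) eq = ≋-trans (≡⇒≋ (ℤP.+-injective (begin
      + a                         ≡⟨ eq ⟩
      + b +ℤ + k *ℤ + s           ≡⟨ cong (+ b +ℤ_) (ℤP.pos-* k s) ⟨
      + b +ℤ + (k * s)            ≡⟨ ℤP.pos-+ b (k * s) ⟨
      + (b + k * s)               ∎))) (+-multiple-≋ b k)
      where open ≡-Reasoning
    +a≡+b+Ks⇒a≋b a b -[1+ k ] eq = ≋-trans (≋-sym (+-multiple-≋ a (suc k))) (≡⇒≋ (ℤP.+-injective (begin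
      + (a + suc k * s)                           ≡⟨ ℤP.pos-+ a (suc k * s) ⟩
      + a +ℤ + (suc k * s)                        ≡⟨ cong (+ a +ℤ_) (ℤP.pos-* (suc k) s) ⟩
      + a +ℤ + suc k *ℤ + s                       ≡⟨ cong (_+ℤ + suc k *ℤ + s) eq ⟩
      + b +ℤ -[1+ k ] *ℤ + s +ℤ + suc k *ℤ + s    ≡⟨ cancel (+ b) (+ suc k) (+ s) ⟩
      + b                                         ∎)))
      where
      open ≡-Reasoning
      cancel : ∀ a k s → a +ℤ (-ℤ k) *ℤ s +ℤ k *ℤ s ≡ a
      cancel = solveℤ-∀

    +a≡-b+Ks⇒a+b≋0 : ∀ a b K → + a ≡ -ℤ + b +ℤ K *ℤ + s → a + b ≋ 0
    +a≡-b+Ks⇒a+b≋0 a b K eq = +a≡+b+Ks⇒a≋b (a + b) 0 K (begin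
      + (a + b)                      ≡⟨ ℤP.pos-+ a b ⟩
      + a +ℤ + b                    ≡⟨ cong (_+ℤ + b) eq ⟩
      -ℤ + b +ℤ K *ℤ + s +ℤ + b  ≡⟨ cancel (+ b) K (+ s) ⟩
      + 0 +ℤ K *ℤ + s              ∎)
      where
      open ≡-Reasoning
      cancel : ∀ b K s → -ℤ b +ℤ K *ℤ s +ℤ b ≡ + 0 +ℤ K *ℤ s
      cancel = solveℤ-∀

[2d+k]%[2d+3]≢0 : ∀ {d} k → 1 ≤ d → k ≤ 6 → k ≢ 3 → (2 * d + k) % suc (2 * d + 2) ≢ 0
[2d+k]%[2d+3]≢0 {d} k 1≤d k≤6 k≢3 with k ≤? 2
... | yes k≤2 = 2d≢0 ∘ m+n≡0⇒m≡0 (2 * d) ∘ trans (sym (m<n⇒m%n≡m (s≤s (+-monoʳ-≤ (2 * d) k≤2))))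
  where
  2d≢0 : 2 * d ≢ 0
  2d≢0 = ≢-nonZero⁻¹ (2 * d) {{m*n≢0 2 d {{_}} {{>-nonZero 1≤d}}}}
... | no k≰2 = λ eq → k≢3 (begin
    k                      ≡⟨ m+[n∸m]≡n 3≤k ⟨
    3 + r                  ≡⟨ cong (λ x → 3 + x) (m<n⇒m%n≡m r<S) ⟨
    3 + r % S              ≡⟨ cong (λ x → 3 + x) ([m+kn]%n≡m%n r 1 S) ⟨
    3 + (r + 1 * S) % S    ≡⟨ cong (λ x → 3 + x % S) split ⟨
    3 + (2 * d + k) % S    ≡⟨ cong (λ x → 3 + x) eq ⟩
    3 + 0                  ∎)
  where
  open ≡-Reasoning
  S r : ℕ
  S = suc (2 * d + 2)
  r = k ∸ 3
  3≤k : 3 ≤ k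
  3≤k = ≰⇒> k≰2
  split : 2 * d + k ≡ r + 1 * S
  split = trans (cong (λ x → 2 * d + x) (sym (m+[n∸m]≡n 3≤k))) (identity d r)
    where
    identity : ∀ d r → 2 * d + (3 + r) ≡ r + 1 * suc (2 * d + 2)
    identity = solve-∀
  r<S : r < S
  r<S = s≤s (≤-trans (∸-monoˡ-≤ 3 k≤6) (+-monoˡ-≤ 2 (≤-trans 1≤d (m≤m+n d (d + 0)))))

-- Increments d + c with c ≤ 3 keep adjacent labels d apart modulo 2d + 3, and two of them
-- cancel modulo 2d + 3 exactly when their c sum to 3.
labeling-mod-2d+3 : ∀ {d m n ℓ} .{{_ : NonZero n}} → 1 ≤ d → 3 ≤ m → suc (2 * d + 2) ∣ n →
  ∀ α β c₊ c₋ {_ : True (c₊ ≤? 3)} {_ : True (c₋ ≤? 3)} {_ : False (c₊ ≟ c₋)}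
  {_ : False (c₊ + c₊ ≟ 3)} {_ : False (c₊ + c₋ ≟ 3)} {_ : False (c₋ + c₋ ≟ 3)} →
  let open Congruence (suc (2 * d + 2)) in
  α * ℓ ≋ β * m → α + β ≋ d + c₊ → β ≋ α + (d + c₋) → LambdaLe d (Bundle m n ℓ) (2 * d + 2)
labeling-mod-2d+3 {d} {m} {n} {ℓ} 1≤d 3≤m S∣n α β c₊ c₋ {c₊≤3} {c₋≤3} {c₊≢c₋} {c₊c₊} {c₊c₋} {c₋c₋}
  compatible up-≋ down-≋ =
  DiagonalLabeling.labeling m n ℓ {{>-nonZero (≤-trans (s≤s z≤n) 3≤m)}} S∣n α β compatible d D up-≋ down-≋
    spread injective no-cancel
  where
  S : ℕ
  S = suc (2 * d + 2)
  c : Dir → ℕ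
  c up   = c₊
  c down = c₋
  D : Dir → ℕ
  D e = d + c e
  c≤3 : ∀ e → c e ≤ 3
  c≤3 up   = toWitness c₊≤3
  c≤3 down = toWitness c₋≤3
  c+c≢3 : ∀ e e′ → c e + c e′ ≢ 3
  c+c≢3 up   up   = toWitnessFalse c₊c₊
  c+c≢3 up   down = toWitnessFalse c₊c₋
  c+c≢3 down up   = toWitnessFalse c₊c₋ ∘ trans (+-comm c₊ c₋)
  c+c≢3 down down = toWitnessFalse c₋c₋
  D<S : ∀ e → D e < S
  D<S e = s≤s (begin
    d + c e        ≤⟨ +-monoʳ-≤ d (c≤3 e) ⟩
    d + 3          ≤⟨ +-monoʳ-≤ d (+-monoˡ-≤ 2 1≤d) ⟩
    d + (d + 2)    ≡⟨ solve (d ∷ []) ⟩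
    2 * d + 2      ∎)
    where open ≤-Reasoning
  spread : ∀ e → d ≤ D e × d + D e ≤ S
  spread e = m≤m+n d (c e) , (begin
    d + (d + c e)      ≤⟨ +-monoʳ-≤ d (+-monoʳ-≤ d (c≤3 e)) ⟩
    d + (d + 3)        ≡⟨ solve (d ∷ []) ⟩
    suc (2 * d + 2)    ∎)
    where open ≤-Reasoning
  open Congruence S using (mod-eq; ≋⇒≡)
  c-injective : ∀ e e′ → D e % S ≡ D e′ % S → c e ≡ c e′
  c-injective e e′ eq = +-cancelˡ-≡ d _ _ (≋⇒≡ (D<S e) (D<S e′) (mod-eq eq))
  injective : ∀ e e′ → D e % S ≡ D e′ % S → e ≡ e′
  injective up   up   _  = refl
  injective down down _  = refl
  injective up   down eq = contradiction (c-injective up down eq) (toWitnessFalse c₊≢c₋)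
  injective down up   eq = contradiction (sym (c-injective down up eq)) (toWitnessFalse c₊≢c₋)
  no-cancel : ∀ e e′ → (D e + D e′) % S ≢ 0
  no-cancel e e′ = subst (λ x → x % S ≢ 0) (sym (identity d (c e) (c e′)))
    ([2d+k]%[2d+3]≢0 (c e + c e′) 1≤d (+-mono-≤ (c≤3 e) (c≤3 e′)) (c+c≢3 e e′))
    where
    identity : ∀ d a b → d + a + (d + b) ≡ 2 * d + (a + b)
    identity = solve-∀

module UpperBound {d m n ℓ : ℕ} .{{_ : NonZero n}} (1≤d : 1 ≤ d) (3≤m : 3 ≤ m) (s∣n : 2 * d + 3 ∣ n)
  where
  open import Data.Integer using (ℤ; +_) renaming (_+_ to _+ℤ_; _*_ to _*ℤ_; -_ to -ℤ_)
  import Data.Integer.Properties as ℤP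
  open import Data.Integer.DivMod using (_%ℕ_)
  open IntegerResidues

  S : ℕ
  S = suc (2 * d + 2)

  s≡S : 2 * d + 3 ≡ S
  s≡S = +-suc (2 * d) 2

  S∣n : S ∣ n
  S∣n = subst (_∣ n) s≡S s∣n

  open Congruence S
  open import Relation.Binary.Reasoning.Setoid ≋-setoid

  labeling-ℓ≡-2m : ℓ + 2 * m ≋ 0 → LambdaLe d (Bundle m n ℓ) (2 * d + 2)
  labeling-ℓ≡-2m ℓ≡-2m =
    labeling-mod-2d+3 1≤d 3≤m S∣n (d + 1) 1 2 3 compatible (≡⇒≋ (+-assoc d 1 1)) down-≋
    where
    compatible : (d + 1) * ℓ ≋ 1 * m
    compatible = begin
      (d + 1) * ℓ                 ≈⟨ +-multiple-≋ ((d + 1) * ℓ) m ⟨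
      (d + 1) * ℓ + m * suc (2 * d + 2) ≡⟨ solve (d ∷ ℓ ∷ m ∷ []) ⟩
      (d + 1) * (ℓ + 2 * m) + m   ≈⟨ +-congʳ m (*-congˡ (d + 1) ℓ≡-2m) ⟩
      (d + 1) * 0 + m             ≡⟨ solve (d ∷ m ∷ []) ⟩
      1 * m                       ∎
    down-≋ : 1 ≋ d + 1 + (d + 3)
    down-≋ = begin
      1                           ≈⟨ +-multiple-≋ 1 1 ⟨
      1 + 1 * suc (2 * d + 2)     ≡⟨ solve (d ∷ []) ⟩
      d + 1 + (d + 3)             ∎

  labeling-ℓ≡2m : ℓ ≋ 2 * m → LambdaLe d (Bundle m n ℓ) (2 * d + 2)
  labeling-ℓ≡2m ℓ≡2m =
    labeling-mod-2d+3 1≤d 3≤m S∣n (d + 1) (2 * d + 2) 0 1 compatible up-≋ (≡⇒≋ (solve (d ∷ [])))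
    where
    compatible : (d + 1) * ℓ ≋ (2 * d + 2) * m
    compatible = begin
      (d + 1) * ℓ                 ≈⟨ *-congˡ (d + 1) ℓ≡2m ⟩
      (d + 1) * (2 * m)           ≡⟨ solve (d ∷ m ∷ []) ⟩
      (2 * d + 2) * m             ∎
    up-≋ : d + 1 + (2 * d + 2) ≋ d + 0
    up-≋ = begin
      d + 1 + (2 * d + 2)         ≡⟨ solve (d ∷ []) ⟩
      d + 0 + 1 * suc (2 * d + 2) ≈⟨ +-multiple-≋ (d + 0) 1 ⟩
      d + 0                       ∎

  labeling-ℓ≡[d+1]m : ℓ ≋ (d + 1) * m → LambdaLe d (Bundle m n ℓ) (2 * d + 2)
  labeling-ℓ≡[d+1]m ℓ≡[d+1]m = labeling-mod-2d+3 1≤d 3≤m S∣n 1 (d + 1) 2 0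
    (≋-trans (≡⇒≋ (*-identityˡ ℓ)) ℓ≡[d+1]m) (≡⇒≋ (solve (d ∷ []))) (≡⇒≋ (solve (d ∷ [])))

  labeling-ℓ≡-[d+1]m : ℓ + (d + 1) * m ≋ 0 → LambdaLe d (Bundle m n ℓ) (2 * d + 2)
  labeling-ℓ≡-[d+1]m ℓ≡-[d+1]m =
    labeling-mod-2d+3 1≤d 3≤m S∣n 1 (d + 2) 3 1 compatible (≡⇒≋ (solve (d ∷ []))) (≡⇒≋ (solve (d ∷ [])))
    where
    compatible : 1 * ℓ ≋ (d + 2) * m
    compatible = begin
      1 * ℓ                       ≈⟨ +-multiple-≋ (1 * ℓ) m ⟨
      1 * ℓ + m * suc (2 * d + 2) ≡⟨ solve (d ∷ ℓ ∷ m ∷ []) ⟩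
      ℓ + (d + 1) * m + (d + 2) * m ≈⟨ +-congʳ ((d + 2) * m) ℓ≡-[d+1]m ⟩
      0 + (d + 2) * m             ∎

  residue : ∀ k c → ℓ ≡ (k *ℤ + (2 * d + 3) +ℤ c) %ℕ n → ∃[ K ] (+ ℓ ≡ c +ℤ K *ℤ + S)
  residue k c eq = [ks+c]%ℕn≡c+Ks S∣n ℓ k c (subst (λ t → ℓ ≡ (k *ℤ + t +ℤ c) %ℕ n) s≡S eq)

  upper-bound : ShiftCond d m n ℓ → LambdaLe d (Bundle m n ℓ) (2 * d + 2)
  upper-bound (inj₁ (_ , k , inj₁ refl , eq)) with K , eq′ ← residue k _ eq =
    labeling-ℓ≡-2m (+a≡-b+Ks⇒a+b≋0 ℓ (2 * m) K (trans eq′ (cong (_+ℤ K *ℤ + S) (ℤP.-1*i≡-i (+ (2 * m))))))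
  upper-bound (inj₁ (_ , k , inj₂ refl , eq)) with K , eq′ ← residue k _ eq =
    labeling-ℓ≡2m (+a≡+b+Ks⇒a≋b ℓ (2 * m) K (trans eq′ (cong (_+ℤ K *ℤ + S) (ℤP.*-identityˡ (+ (2 * m))))))
  upper-bound (inj₂ (_ , k , inj₁ refl , eq)) with K , eq′ ← residue k _ eq =
    labeling-ℓ≡[d+1]m (+a≡+b+Ks⇒a≋b ℓ ((d + 1) * m) K (trans eq′ (cong (_+ℤ K *ℤ + S)
      (trans (cong -ℤ_ (ℤP.-1*i≡-i (+ ((d + 1) * m)))) (ℤP.neg-involutive (+ ((d + 1) * m)))))))
  upper-bound (inj₂ (_ , k , inj₂ refl , eq)) with K , eq′ ← residue k _ eq =
    labeling-ℓ≡-[d+1]m (+a≡-b+Ks⇒a+b≋0 ℓ ((d + 1) * m) K (trans eq′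
      (cong (λ c → -ℤ c +ℤ K *ℤ + S) (ℤP.*-identityˡ (+ ((d + 1) * m))))))

lower-bound : ∀ {d m n ℓ} .{{_ : NonZero n}} → 1 ≤ d → d ≤ 4 → 3 ≤ m → 3 ≤ n →
  ∀ μ → μ < 2 * d + 2 → ¬ LambdaLe d (Bundle m n ℓ) μ
lower-bound {d} {m} {n} {ℓ} 1≤d d≤4 3≤m 3≤n μ μ<2d+2 (_ , labeling) =
  grid-lower-bound d 1≤d d≤4 μ μ<2d+2 (pullback embed embed-homomorphism embed-separates 1≤d labeling)
  where
  open BundleSteps m n ℓ {{>-nonZero (≤-trans (s≤s z≤n) 3≤m)}}
  swap : ∀ {u v} → Bundle m n ℓ u v → Bundle m n ℓ v u
  swap (inj₁ uv) = inj₂ uv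
  swap (inj₂ vu) = inj₁ vu
  origin : Vertex
  origin = fromℕ< (≤-trans (s≤s z≤n) 3≤m) , fromℕ< (≤-trans (s≤s z≤n) 3≤n)
  open GridImmersion (Bundle m n ℓ) swap step (λ e u → inj₁ (step-adjacent e u)) (step-comm up down)
    (up≢down 3≤n) (no-return 3≤m) origin

theorem1 : (d m n ℓ : ℕ) .{{_ : NonZero n}} → 1 ≤ d → 3 ≤ m → (2 * d + 3) ∣ n → ℓ < n → ShiftCond d m n ℓ → LambdaLe d (Bundle m n ℓ) (2 * d + 2) × (d ≤ 4 → LambdaEq d (Bundle m n ℓ) (2 * d + 2))
theorem1 d m n ℓ 1≤d 3≤m s∣n _ shift = labeling , λ d≤4 → labeling , lower-bound 1≤d d≤4 3≤m 3≤n
  where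
  labeling : LambdaLe d (Bundle m n ℓ) (2 * d + 2)
  labeling = UpperBound.upper-bound 1≤d 3≤m s∣n shift
  3≤n : 3 ≤ n
  3≤n = ≤-trans (m≤n+m 3 (2 * d)) (∣⇒≤ s∣n)
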